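{- Let $n,k$ be integers. (1) If $0\le k\le n$, then $\binom{n}{k}_q$ is a polynomial in $q$ of degree $k(n-k)$. (2) If $n<0\le k$, then $\binom{n}{k}_q$ equals $q^{\frac12 k(2n-k+1)}$ times a polynomial in $q$ of degree $k(-n-1)$. (3) If $k\le n<0$, then $\binom{n}{k}_q$ equals $q^{\frac12(n(n+1)-k(k+1))}$ times a polynomial in $q$ of degree $(-n-1)(n-k)$. In each case, the polynomial is self-reciprocal and has integer coefficients.
   Context: For an integer $n\ge 0$, $(a;q)_n=\prod_{j=0}^{n-1}(1-aq^j)$, and for $n<0$, $(a;q)_n=\prod_{j=1}^{|n|}\frac{1}{1-aq^{ -j}}$. For all integers $n,k$, $\binom{n}{k}_q := \lim_{a\to q} \frac{(a;q)_n}{(a;q)_k\,(a;q)_{n-k}}$ (a Laurent polynomial in $q$). A polynomial $P$ of degree $d$ is self-reciprocal if $q^dP(1/q)=P(q)$. -}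

module Defs where

open import Data.Nat using (ℕ; zero; suc)
open import Data.Integer using (ℤ; +_; -[1+_]; _+_; _-_; _*_; -_; 0ℤ; 1ℤ; -1ℤ; _≟_; _/_)
open import Data.List using (List; []; _∷_; _++_; map; upTo; length; foldr; concatMap; zip; _∷ʳ_)
open import Data.Product using (Σ; _×_; _,_; proj₁; proj₂)
open import Data.Maybe using (Maybe; just; nothing)
open import Relation.Nullary using (yes; no; ¬_)
open import Relation.Binary.PropositionalEquality using (_≡_)

-- Laurent polynomials in q with integer coefficients, represented as
-- finite lists of terms (c , e) meaning c·q^e.  Two Laurent polynomials
-- are equal (≈ᴸ) iff all their coefficients agree.

LPoly : Set
LPoly = List (ℤ × ℤ)

coeff : LPoly → ℤ → ℤ
coeff [] i = 0ℤ
coeff ((c , e) ∷ p) i with e ≟ i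
... | yes _ = c + coeff p i
... | no  _ = coeff p i

_≈ᴸ_ : LPoly → LPoly → Set
p ≈ᴸ r = ∀ i → coeff p i ≡ coeff r i

oneL : LPoly
oneL = (1ℤ , 0ℤ) ∷ []

monoL : ℤ → LPoly
monoL e = (1ℤ , e) ∷ []

_*ᴸ_ : LPoly → LPoly → LPoly
p *ᴸ r = concatMap (λ t → map (λ s → (proj₁ t * proj₁ s , proj₂ t + proj₂ s)) r) p

-- Polynomials in q with integer coefficients: coefficient lists
-- [c₀ , c₁ , … , c_d] meaning Σ c_j q^j.

Poly : Set
Poly = List ℤ

indexed : ℕ → Poly → List (ℤ × ℤ)
indexed j [] = []
indexed j (c ∷ cs) = (c , + j) ∷ indexed (suc j) cs

toL : Poly → LPoly
toL P = indexed 0 P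

HasDegree : Poly → ℤ → Set
HasDegree P d = Σ Poly λ cs → Σ ℤ λ c → (P ≡ cs ∷ʳ c) × (¬ c ≡ 0ℤ) × (+ length cs ≡ d)

reciprocalL : ℤ → Poly → LPoly
reciprocalL d P = map (λ t → (proj₁ t , d - proj₂ t)) (toL P)

-- self-reciprocal (with respect to its degree d): q^d P(1/q) = P(q)
SelfReciprocal : ℤ → Poly → Set
SelfReciprocal d P = reciprocalL d P ≈ᴸ toL P

-- Rational functions in q: num / den, with den a product of factors
-- (1 - q^r), r ≠ 0 (hence nonzero).

record RatFun : Set where
  constructor _//_
  field
    num : LPoly
    den : LPoly
open RatFun public

-- Formal products ∏ (1 - a q^m)^e, as lists of pairs (m , e).

Factor : Set
Factor = ℤ × ℤ

poch : ℤ → List Factor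
poch (+ n)      = map (λ j → (+ j , 1ℤ)) (upTo n)
poch (-[1+ n ]) = map (λ j → (- (+ suc j) , -1ℤ)) (upTo (suc n))   -- ∏_{j=1}^{|n|} (1 - a q^{-j})^{-1}

invF : List Factor → List Factor
invF = map (λ f → (proj₁ f , - proj₂ f))

binomFactors : ℤ → ℤ → List Factor
binomFactors n k = poch n ++ invF (poch k) ++ invF (poch (n - k))

-- total exponent of the factor (1 - a q^{-1}), the only factor vanishing at a = q
poleExp : List Factor → ℤ
poleExp [] = 0ℤ
poleExp ((m , e) ∷ fs) with m ≟ -1ℤ
... | yes _ = e + poleExp fs
... | no  _ = poleExp fs

oneMinus : ℤ → LPoly
oneMinus r = (1ℤ , 0ℤ) ∷ (-1ℤ , r) ∷ []

powL : LPoly → ℕ → LPoly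
powL p zero = oneL
powL p (suc n) = p *ᴸ powL p n

-- value at a = q of the product of the factors with m ≠ -1
regularValue : List Factor → RatFun
regularValue [] = oneL // oneL
regularValue ((m , e) ∷ fs) with m ≟ -1ℤ | regularValue fs
... | yes _ | r = r
... | no _  | N // D with e
...   | + j      = (powL (oneMinus (m + 1ℤ)) j *ᴸ N) // D
...   | -[1+ j ] = N // (powL (oneMinus (m + 1ℤ)) (suc j) *ᴸ D)

-- lim_{a→q} ∏ (1 - a q^m)^e : nothing if it diverges
limAtQ : List Factor → Maybe RatFun
limAtQ fs with poleExp fs
... | + zero    = just (regularValue fs)
... | + suc _    = just ([] // oneL)          -- a zero of (1 - a/q) survives: limit 0
... | -[1+ _ ]  = nothing                   -- pole survives: no finite limit

qbinom : ℤ → ℤ → Maybe RatFun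
qbinom n k = limAtQ (binomFactors n k)

EqualsMonoTimes : Maybe RatFun → ℤ → Poly → Set
EqualsMonoTimes x e P = Σ RatFun λ r → (x ≡ just r) × (num r ≈ᴸ ((monoL e *ᴸ toL P) *ᴸ den r))

MonoTimesSelfRecip : Maybe RatFun → ℤ → ℤ → Set
MonoTimesSelfRecip x e d = Σ Poly λ P → HasDegree P d × SelfReciprocal d P × EqualsMonoTimes x e P

half : ℤ → ℤ
half z = z / + 2

-- For 0 ≤ k ≤ n the limit a → q of the product is (q;q)_n / ((q;q)_k (q;q)_(n-k)).
-- The Gaussian polynomials G(a,b), defined by the q-Pascal recurrence, satisfy
-- G(a,b) (q;q)_a = (q^(b+1);q)_a, so the limit is G(k, n-k).  For n < 0 the
-- factor 1 - a/q cancels between numerator and denominator, and the remaining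
-- factors 1 - q^(-j) = -q^(-j) (1 - q^j) turn the limit into ±q^e G(c, -n-1),
-- where c = k or c = n - k.  Self-reciprocity of G(a,b) comes from substituting
-- q ↦ q⁻¹ in the product formula and cancelling (q;q)_a, which is legitimate
-- because a Laurent polynomial annihilated by 1 - q^j has j-periodic, finitely
-- supported coefficients and so vanishes.

module Submission where

open import Defs
open import Data.Nat as ℕ using (ℕ; zero; suc)
import Data.Nat.Properties as ℕₚ
import Data.Nat.Tactic.RingSolver as NatSolver
open import Data.Nat.DivMod using (m*n/n≡m; m*n%n≡0)
open import Data.Integer
  using (ℤ; +_; -[1+_]; _+_; _-_; _*_; -_; ∣_∣; _/ℕ_; _≤_; _<_; +≤+; -≤-; -<+; 0ℤ; 1ℤ; -1ℤ; _≟_)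
import Data.Integer.Properties as ℤₚ
open import Data.Integer.Tactic.RingSolver using (solve-∀)
open import Data.List using (List; []; _∷_; [_]; _++_; _∷ʳ_; map; replicate; length; applyUpTo; iterate)
import Data.List.Properties as Listₚ
open import Data.List.Relation.Unary.All using (All; []; _∷_; all?; lookupWith)
open import Data.List.Relation.Unary.All.Properties using (¬Any⇒All¬)
open import Data.List.Relation.Unary.Any using (any?)
open import Data.Maybe using (Maybe; just; nothing)
open import Data.Product using (Σ; _×_; _,_; proj₁; proj₂)
open import Relation.Nullary using (yes; no; ¬_; contradiction)
open import Relation.Binary.PropositionalEquality
  using (_≡_; refl; sym; trans; cong; cong₂; subst; subst₂; module ≡-Reasoning)
open import Algebra.Bundles using (CommutativeRing)
open import Tactic.RingSolver.Core.AlmostCommutativeRing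
  using (AlmostCommutativeRing; fromCommutativeRing)
import Tactic.RingSolver.NonReflective as RingSolver
import Relation.Binary.Reasoning.Setoid as SetoidReasoning

x+y≡z⇒y≡z-x : ∀ x y z → x + y ≡ z → y ≡ z - x
x+y≡z⇒y≡z-x x y _ refl = lemma x y
  where
  lemma : ∀ x y → y ≡ (x + y) - x
  lemma = solve-∀

y≡z-x⇒x+y≡z : ∀ x y z → y ≡ z - x → x + y ≡ z
y≡z-x⇒x+y≡z x _ z refl = lemma x z
  where
  lemma : ∀ x z → x + (z - x) ≡ z
  lemma = solve-∀

d-[d-e]≡e : ∀ d e → d - (d - e) ≡ e
d-[d-e]≡e = solve-∀

coeff-∷ : ∀ t p i → coeff (t ∷ p) i ≡ coeff [ t ] i + coeff p i
coeff-∷ (c , e) p i with e ≟ i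
... | yes _ = cong (_+ coeff p i) (sym (ℤₚ.+-identityʳ c))
... | no  _ = sym (ℤₚ.+-identityˡ _)

coeff-++ : ∀ p r i → coeff (p ++ r) i ≡ coeff p i + coeff r i
coeff-++ []      r i = sym (ℤₚ.+-identityˡ _)
coeff-++ (t ∷ p) r i = begin
  coeff (t ∷ p ++ r) i                      ≡⟨ coeff-∷ t (p ++ r) i ⟩
  coeff [ t ] i + coeff (p ++ r) i          ≡⟨ cong (_+_ (coeff [ t ] i)) (coeff-++ p r i) ⟩
  coeff [ t ] i + (coeff p i + coeff r i)   ≡⟨ sym (ℤₚ.+-assoc (coeff [ t ] i) _ _) ⟩
  (coeff [ t ] i + coeff p i) + coeff r i   ≡⟨ cong (_+ coeff r i) (coeff-∷ t p i) ⟨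
  coeff (t ∷ p) i + coeff r i               ∎
  where open ≡-Reasoning

scaleShift : ℤ → ℤ → LPoly → LPoly
scaleShift c e = map (λ s → (c * proj₁ s , e + proj₂ s))

coeff-scaleShift : ∀ c e r i → coeff (scaleShift c e r) i ≡ c * coeff r (i - e)
coeff-scaleShift c e []             i = sym (ℤₚ.*-zeroʳ c)
coeff-scaleShift c e ((c′ , e′) ∷ r) i with e + e′ ≟ i | e′ ≟ i - e
... | yes _      | yes _      =
  trans (cong (_+_ (c * c′)) (coeff-scaleShift c e r i)) (sym (ℤₚ.*-distribˡ-+ c c′ _))
... | yes e+e′≡i | no e′≢i-e  = contradiction (x+y≡z⇒y≡z-x e e′ i e+e′≡i) e′≢i-e
... | no e+e′≢i  | yes e′≡i-e = contradiction (y≡z-x⇒x+y≡z e e′ i e′≡i-e) e+e′≢i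
... | no _       | no _       = coeff-scaleShift c e r i

infixl 7 _⋆_
_⋆_ : LPoly → (ℤ → ℤ) → ℤ → ℤ
([]            ⋆ f) i = 0ℤ
(((c , e) ∷ p) ⋆ f) i = c * f (i - e) + (p ⋆ f) i

coeff-*ᴸ : ∀ p r i → coeff (p *ᴸ r) i ≡ (p ⋆ coeff r) i
coeff-*ᴸ []            r i = refl
coeff-*ᴸ ((c , e) ∷ p) r i =
  trans (coeff-++ (scaleShift c e r) (p *ᴸ r) i)
        (cong₂ _+_ (coeff-scaleShift c e r i) (coeff-*ᴸ p r i))

⋆-cong : ∀ p {f g} → (∀ j → f j ≡ g j) → ∀ i → (p ⋆ f) i ≡ (p ⋆ g) i
⋆-cong []            f≗g i = refl
⋆-cong ((c , e) ∷ p) f≗g i = cong₂ (λ x y → c * x + y) (f≗g (i - e)) (⋆-cong p f≗g i)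

⋆-zero : ∀ p i → (p ⋆ (λ _ → 0ℤ)) i ≡ 0ℤ
⋆-zero []            i = refl
⋆-zero ((c , e) ∷ p) i = cong₂ _+_ (ℤₚ.*-zeroʳ c) (⋆-zero p i)

⋆-+ : ∀ p f g i → (p ⋆ (λ j → f j + g j)) i ≡ (p ⋆ f) i + (p ⋆ g) i
⋆-+ []            f g i = refl
⋆-+ ((c , e) ∷ p) f g i =
  trans (cong (_+_ (c * (f (i - e) + g (i - e)))) (⋆-+ p f g i))
        (lemma c (f (i - e)) (g (i - e)) ((p ⋆ f) i) ((p ⋆ g) i))
  where
  lemma : ∀ c a b x y → c * (a + b) + (x + y) ≡ (c * a + x) + (c * b + y)
  lemma = solve-∀

⋆-++ : ∀ p r f i → ((p ++ r) ⋆ f) i ≡ (p ⋆ f) i + (r ⋆ f) i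
⋆-++ []            r f i = sym (ℤₚ.+-identityˡ _)
⋆-++ ((c , e) ∷ p) r f i =
  trans (cong (_+_ (c * f (i - e))) (⋆-++ p r f i))
        (sym (ℤₚ.+-assoc (c * f (i - e)) ((p ⋆ f) i) ((r ⋆ f) i)))

⋆-scaleShift : ∀ c e r f i → (scaleShift c e r ⋆ f) i ≡ c * (r ⋆ f) (i - e)
⋆-scaleShift c e []             f i = sym (ℤₚ.*-zeroʳ c)
⋆-scaleShift c e ((c′ , e′) ∷ r) f i =
  trans (cong₂ (λ x y → c * c′ * f x + y) (sub-+ i e e′) (⋆-scaleShift c e r f i))
        (lemma c c′ (f (i - e - e′)) ((r ⋆ f) (i - e)))
  where
  sub-+ : ∀ i e e′ → i - (e + e′) ≡ i - e - e′
  sub-+ = solve-∀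
  lemma : ∀ c c′ x y → c * c′ * x + c * y ≡ c * (c′ * x + y)
  lemma = solve-∀

⋆-*ᴸ : ∀ p r f i → ((p *ᴸ r) ⋆ f) i ≡ (p ⋆ (r ⋆ f)) i
⋆-*ᴸ []            r f i = refl
⋆-*ᴸ ((c , e) ∷ p) r f i =
  trans (⋆-++ (scaleShift c e r) (p *ᴸ r) f i)
        (cong₂ _+_ (⋆-scaleShift c e r f i) (⋆-*ᴸ p r f i))

⋆-coeff-single : ∀ r c e i → (r ⋆ coeff [ (c , e) ]) i ≡ c * coeff r (i - e)
⋆-coeff-single []              c e i = sym (ℤₚ.*-zeroʳ c)
⋆-coeff-single ((c′ , e′) ∷ r) c e i with e ≟ i - e′ | e′ ≟ i - e
... | yes _ | yes _ =
  trans (cong (_+_ (c′ * (c + 0ℤ))) (⋆-coeff-single r c e i)) (lemma c c′ (coeff r (i - e)))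
  where
  lemma : ∀ c c′ x → c′ * (c + 0ℤ) + c * x ≡ c * (c′ + x)
  lemma = solve-∀
... | yes e≡i-e′ | no e′≢i-e =
  contradiction (x+y≡z⇒y≡z-x e e′ i (trans (ℤₚ.+-comm e e′) (y≡z-x⇒x+y≡z e′ e i e≡i-e′))) e′≢i-e
... | no e≢i-e′ | yes e′≡i-e =
  contradiction (x+y≡z⇒y≡z-x e′ e i (trans (ℤₚ.+-comm e′ e) (y≡z-x⇒x+y≡z e e′ i e′≡i-e))) e≢i-e′
... | no _ | no _ =
  trans (cong₂ _+_ (ℤₚ.*-zeroʳ c′) (⋆-coeff-single r c e i)) (ℤₚ.+-identityˡ _)

⋆-comm : ∀ p r i → (p ⋆ coeff r) i ≡ (r ⋆ coeff p) i
⋆-comm []            r i = sym (⋆-zero r i)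
⋆-comm ((c , e) ∷ p) r i = sym (begin
  (r ⋆ coeff ((c , e) ∷ p)) i                           ≡⟨ ⋆-cong r (coeff-∷ (c , e) p) i ⟩
  (r ⋆ (λ j → coeff [ (c , e) ] j + coeff p j)) i       ≡⟨ ⋆-+ r (coeff [ (c , e) ]) (coeff p) i ⟩
  (r ⋆ coeff [ (c , e) ]) i + (r ⋆ coeff p) i           ≡⟨ cong₂ _+_ (⋆-coeff-single r c e i) (sym (⋆-comm p r i)) ⟩
  c * coeff r (i - e) + (p ⋆ coeff r) i                 ∎)
  where open ≡-Reasoning

-- The ring of Laurent polynomials

negL : LPoly → LPoly
negL = map (λ t → (- proj₁ t , proj₂ t))

coeff-negL : ∀ p i → coeff (negL p) i ≡ - coeff p i
coeff-negL []            i = refl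
coeff-negL ((c , e) ∷ p) i with e ≟ i
... | yes _ = trans (cong (_+_ (- c)) (coeff-negL p i)) (sym (ℤₚ.neg-distrib-+ c _))
... | no  _ = coeff-negL p i

-- A record, so that p and r can be inferred from a proof of p ≈ r.
infix 4 _≈_
record _≈_ (p r : LPoly) : Set where
  constructor mk≈
  field coeff-≡ : p ≈ᴸ r
open _≈_

≈-refl : ∀ {p} → p ≈ p
≈-refl = mk≈ λ _ → refl

≈-sym : ∀ {p r} → p ≈ r → r ≈ p
≈-sym (mk≈ eq) = mk≈ λ i → sym (eq i)

≈-trans : ∀ {p r s} → p ≈ r → r ≈ s → p ≈ s
≈-trans (mk≈ eq) (mk≈ eq′) = mk≈ λ i → trans (eq i) (eq′ i)

≡⇒≈ : ∀ {p r} → p ≡ r → p ≈ r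
≡⇒≈ refl = ≈-refl

++-cong : ∀ {p p′ r r′} → p ≈ p′ → r ≈ r′ → p ++ r ≈ p′ ++ r′
++-cong {p} {p′} {r} {r′} (mk≈ eq) (mk≈ eq′) = mk≈ λ i →
  trans (coeff-++ p r i) (trans (cong₂ _+_ (eq i) (eq′ i)) (sym (coeff-++ p′ r′ i)))

++-comm : ∀ p r → p ++ r ≈ r ++ p
++-comm p r = mk≈ λ i →
  trans (coeff-++ p r i) (trans (ℤₚ.+-comm (coeff p i) _) (sym (coeff-++ r p i)))

++-assoc : ∀ p r s → (p ++ r) ++ s ≈ p ++ (r ++ s)
++-assoc p r s = ≡⇒≈ (Listₚ.++-assoc p r s)

++-identityʳ : ∀ p → p ++ [] ≈ p
++-identityʳ p = ≡⇒≈ (Listₚ.++-identityʳ p)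

negL-inverseˡ : ∀ p → negL p ++ p ≈ []
negL-inverseˡ p = mk≈ λ i →
  trans (coeff-++ (negL p) p i)
        (trans (cong (_+ coeff p i) (coeff-negL p i)) (ℤₚ.+-inverseˡ (coeff p i)))

negL-cong : ∀ {p r} → p ≈ r → negL p ≈ negL r
negL-cong {p} {r} (mk≈ eq) = mk≈ λ i →
  trans (coeff-negL p i) (trans (cong -_ (eq i)) (sym (coeff-negL r i)))

*ᴸ-comm : ∀ p r → p *ᴸ r ≈ r *ᴸ p
*ᴸ-comm p r = mk≈ λ i →
  trans (coeff-*ᴸ p r i) (trans (⋆-comm p r i) (sym (coeff-*ᴸ r p i)))

*ᴸ-congˡ : ∀ p {r r′} → r ≈ r′ → p *ᴸ r ≈ p *ᴸ r′
*ᴸ-congˡ p {r} {r′} (mk≈ eq) = mk≈ λ i →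
  trans (coeff-*ᴸ p r i) (trans (⋆-cong p eq i) (sym (coeff-*ᴸ p r′ i)))

*ᴸ-cong : ∀ {p p′ r r′} → p ≈ p′ → r ≈ r′ → p *ᴸ r ≈ p′ *ᴸ r′
*ᴸ-cong {p} {p′} {r} {r′} p≈p′ r≈r′ =
  ≈-trans (*ᴸ-congˡ p r≈r′)
    (≈-trans (*ᴸ-comm p r′) (≈-trans (*ᴸ-congˡ r′ p≈p′) (*ᴸ-comm r′ p′)))

*ᴸ-assoc : ∀ p r s → (p *ᴸ r) *ᴸ s ≈ p *ᴸ (r *ᴸ s)
*ᴸ-assoc p r s = mk≈ λ i → begin
  coeff ((p *ᴸ r) *ᴸ s) i      ≡⟨ coeff-*ᴸ (p *ᴸ r) s i ⟩
  ((p *ᴸ r) ⋆ coeff s) i       ≡⟨ ⋆-*ᴸ p r (coeff s) i ⟩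
  (p ⋆ (r ⋆ coeff s)) i        ≡⟨ ⋆-cong p (λ j → sym (coeff-*ᴸ r s j)) i ⟩
  (p ⋆ coeff (r *ᴸ s)) i       ≡⟨ coeff-*ᴸ p (r *ᴸ s) i ⟨
  coeff (p *ᴸ (r *ᴸ s)) i      ∎
  where open ≡-Reasoning

*ᴸ-identityˡ : ∀ p → oneL *ᴸ p ≈ p
*ᴸ-identityˡ p = mk≈ λ i →
  trans (coeff-*ᴸ oneL p i)
        (trans (ℤₚ.+-identityʳ _)
               (trans (ℤₚ.*-identityˡ _) (cong (coeff p) (ℤₚ.+-identityʳ i))))

*ᴸ-identityʳ : ∀ p → p *ᴸ oneL ≈ p
*ᴸ-identityʳ p = ≈-trans (*ᴸ-comm p oneL) (*ᴸ-identityˡ p)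

*ᴸ-distribˡ : ∀ p r s → p *ᴸ (r ++ s) ≈ (p *ᴸ r) ++ (p *ᴸ s)
*ᴸ-distribˡ p r s = mk≈ λ i → begin
  coeff (p *ᴸ (r ++ s)) i                     ≡⟨ coeff-*ᴸ p (r ++ s) i ⟩
  (p ⋆ coeff (r ++ s)) i                      ≡⟨ ⋆-cong p (coeff-++ r s) i ⟩
  (p ⋆ (λ j → coeff r j + coeff s j)) i       ≡⟨ ⋆-+ p (coeff r) (coeff s) i ⟩
  (p ⋆ coeff r) i + (p ⋆ coeff s) i           ≡⟨ cong₂ _+_ (coeff-*ᴸ p r i) (coeff-*ᴸ p s i) ⟨
  coeff (p *ᴸ r) i + coeff (p *ᴸ s) i         ≡⟨ coeff-++ (p *ᴸ r) (p *ᴸ s) i ⟨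
  coeff ((p *ᴸ r) ++ (p *ᴸ s)) i              ∎
  where open ≡-Reasoning

laurentRing : CommutativeRing _ _
laurentRing = record
  { Carrier = LPoly
  ; _≈_ = _≈_
  ; _+_ = _++_
  ; _*_ = _*ᴸ_
  ; -_ = negL
  ; 0# = []
  ; 1# = oneL
  ; isCommutativeRing = record
    { isRing = record
      { +-isAbelianGroup = record
        { isGroup = record
          { isMonoid = record
            { isSemigroup = record
              { isMagma = record
                { isEquivalence = record { refl = ≈-refl ; sym = ≈-sym ; trans = ≈-trans }
                ; ∙-cong = ++-cong
                }
              ; assoc = ++-assoc
              }
            ; identity = (λ _ → ≈-refl) , ++-identityʳ
            }
          ; inverse = negL-inverseˡ , λ p → ≈-trans (++-comm p (negL p)) (negL-inverseˡ p)
          ; ⁻¹-cong = negL-cong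
          }
        ; comm = ++-comm
        }
      ; *-cong = *ᴸ-cong
      ; *-assoc = *ᴸ-assoc
      ; *-identity = *ᴸ-identityˡ , *ᴸ-identityʳ
      ; distrib = *ᴸ-distribˡ , λ p r s →
          ≈-trans (*ᴸ-comm (r ++ s) p)
            (≈-trans (*ᴸ-distribˡ p r s) (++-cong (*ᴸ-comm p r) (*ᴸ-comm p s)))
      }
    ; *-comm = *ᴸ-comm
    }
  }

coeff-absent : ∀ p i → All (λ t → ¬ proj₂ t ≡ i) p → coeff p i ≡ 0ℤ
coeff-absent []            i []             = refl
coeff-absent ((c , e) ∷ p) i (e≢i ∷ absent) with e ≟ i
... | yes e≡i = contradiction e≡i e≢i
... | no  _   = coeff-absent p i absent

-- The ring solver cancels terms only when this test recognises them as zero.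
[]≈? : ∀ p → Maybe ([] ≈ p)
[]≈? p with all? (λ t → coeff p (proj₂ t) ≟ 0ℤ) p
... | no  _      = nothing
... | yes vanish = just (mk≈ λ i → sym (coeff≡0 i))
  where
  coeff≡0 : ∀ i → coeff p i ≡ 0ℤ
  coeff≡0 i with any? (λ t → proj₂ t ≟ i) p
  ... | yes occurs = lookupWith (λ c≡0 e≡i → subst (λ j → coeff p j ≡ 0ℤ) e≡i c≡0) vanish occurs
  ... | no  absent = coeff-absent p i (¬Any⇒All¬ p absent)

laurent : AlmostCommutativeRing _ _
laurent = fromCommutativeRing laurentRing []≈?

open RingSolver laurent using (solve; _⊜_; _⊕_; _⊗_; ⊝_; Κ)

*ᴸ-interchange : ∀ w x y z → (w *ᴸ x) *ᴸ (y *ᴸ z) ≈ (w *ᴸ y) *ᴸ (x *ᴸ z)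
*ᴸ-interchange = solve 4 (λ w x y z → ((w ⊗ x) ⊗ (y ⊗ z)) ⊜ ((w ⊗ y) ⊗ (x ⊗ z))) ≈-refl

-- The substitution q ↦ q⁻¹

atInverse : LPoly → LPoly
atInverse = map (λ t → (proj₁ t , - proj₂ t))

coeff-atInverse : ∀ p i → coeff (atInverse p) i ≡ coeff p (- i)
coeff-atInverse []            i = refl
coeff-atInverse ((c , e) ∷ p) i with - e ≟ i | e ≟ - i
... | yes _ | yes _ = cong (_+_ c) (coeff-atInverse p i)
... | yes -e≡i | no e≢-i = contradiction (trans (sym (ℤₚ.neg-involutive e)) (cong -_ -e≡i)) e≢-i
... | no -e≢i | yes e≡-i = contradiction (trans (cong -_ e≡-i) (ℤₚ.neg-involutive i)) -e≢i
... | no _ | no _ = coeff-atInverse p i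

⋆-atInverse : ∀ p f i → (atInverse p ⋆ f) i ≡ (p ⋆ (λ j → f (- j))) (- i)
⋆-atInverse []            f i = refl
⋆-atInverse ((c , e) ∷ p) f i =
  cong₂ (λ x y → c * f x + y) (lemma i e) (⋆-atInverse p f i)
  where
  lemma : ∀ i e → i - - e ≡ - (- i - e)
  lemma = solve-∀

atInverse-cong : ∀ {p r} → p ≈ r → atInverse p ≈ atInverse r
atInverse-cong {p} {r} (mk≈ eq) = mk≈ λ i →
  trans (coeff-atInverse p i) (trans (eq (- i)) (sym (coeff-atInverse r i)))

atInverse-*ᴸ : ∀ p r → atInverse (p *ᴸ r) ≈ atInverse p *ᴸ atInverse r
atInverse-*ᴸ p r = mk≈ λ i → begin
  coeff (atInverse (p *ᴸ r)) i                   ≡⟨ coeff-atInverse (p *ᴸ r) i ⟩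
  coeff (p *ᴸ r) (- i)                           ≡⟨ coeff-*ᴸ p r (- i) ⟩
  (p ⋆ coeff r) (- i)                            ≡⟨ ⋆-cong p coeff-r≡ (- i) ⟩
  (p ⋆ (λ j → coeff (atInverse r) (- j))) (- i)  ≡⟨ ⋆-atInverse p (coeff (atInverse r)) i ⟨
  (atInverse p ⋆ coeff (atInverse r)) i          ≡⟨ coeff-*ᴸ (atInverse p) (atInverse r) i ⟨
  coeff (atInverse p *ᴸ atInverse r) i           ∎
  where
  open ≡-Reasoning
  coeff-r≡ : ∀ j → coeff r j ≡ coeff (atInverse r) (- j)
  coeff-r≡ j = trans (cong (coeff r) (sym (ℤₚ.neg-involutive j))) (sym (coeff-atInverse r (- j)))

coeff-reciprocalL : ∀ d P i → coeff (reciprocalL d P) i ≡ coeff (toL P) (d - i)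
coeff-reciprocalL d P = go (toL P)
  where
  go : ∀ L i → coeff (map (λ t → (proj₁ t , d - proj₂ t)) L) i ≡ coeff L (d - i)
  go []            i = refl
  go ((c , e) ∷ L) i with d - e ≟ i | e ≟ d - i
  ... | yes _ | yes _ = cong (_+_ c) (go L i)
  ... | yes d-e≡i | no e≢d-i = contradiction (trans (sym (d-[d-e]≡e d e)) (cong (_-_ d) d-e≡i)) e≢d-i
  ... | no d-e≢i | yes e≡d-i = contradiction (trans (cong (_-_ d) e≡d-i) (d-[d-e]≡e d i)) d-e≢i
  ... | no _ | no _ = go L i

reciprocalL≈ : ∀ d P → reciprocalL d P ≈ monoL d *ᴸ atInverse (toL P)
reciprocalL≈ d P = mk≈ λ i → trans (coeff-reciprocalL d P i) (sym (begin
  coeff (monoL d *ᴸ atInverse (toL P)) i   ≡⟨ coeff-*ᴸ (monoL d) (atInverse (toL P)) i ⟩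
  1ℤ * coeff (atInverse (toL P)) (i - d) + 0ℤ
                                           ≡⟨ trans (ℤₚ.+-identityʳ _) (ℤₚ.*-identityˡ _) ⟩
  coeff (atInverse (toL P)) (i - d)        ≡⟨ coeff-atInverse (toL P) (i - d) ⟩
  coeff (toL P) (- (i - d))                ≡⟨ cong (coeff (toL P)) (lemma i d) ⟩
  coeff (toL P) (d - i)                    ∎))
  where
  open ≡-Reasoning
  lemma : ∀ i d → - (i - d) ≡ d - i
  lemma = solve-∀

infixl 6 _+ᴾ_
_+ᴾ_ : Poly → Poly → Poly
[]      +ᴾ Q       = Q
(a ∷ P) +ᴾ []      = a ∷ P
(a ∷ P) +ᴾ (b ∷ Q) = (a + b) ∷ (P +ᴾ Q)

negᴾ : Poly → Poly
negᴾ = map (λ a → - a)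

shiftᴾ : ℕ → Poly → Poly
shiftᴾ m P = replicate m 0ℤ ++ P

single-+ : ∀ a b e → [ (a + b , e) ] ≈ [ (a , e) ] ++ [ (b , e) ]
single-+ a b e = mk≈ λ i → trans (lemma i) (sym (coeff-++ [ (a , e) ] [ (b , e) ] i))
  where
  split : ∀ a b → a + b + 0ℤ ≡ (a + 0ℤ) + (b + 0ℤ)
  split = solve-∀

  lemma : ∀ i → coeff [ (a + b , e) ] i ≡ coeff [ (a , e) ] i + coeff [ (b , e) ] i
  lemma i with e ≟ i
  ... | yes _ = split a b
  ... | no  _ = refl

indexed-+ᴾ : ∀ j P Q → indexed j (P +ᴾ Q) ≈ indexed j P ++ indexed j Q
indexed-+ᴾ j []      Q       = ≈-refl
indexed-+ᴾ j (a ∷ P) []      = ≈-sym (++-identityʳ (indexed j (a ∷ P)))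
indexed-+ᴾ j (a ∷ P) (b ∷ Q) = begin
  [ (a + b , + j) ] ++ indexed (suc j) (P +ᴾ Q)
    ≈⟨ ++-cong (single-+ a b (+ j)) (indexed-+ᴾ (suc j) P Q) ⟩
  ([ (a , + j) ] ++ [ (b , + j) ]) ++ (indexed (suc j) P ++ indexed (suc j) Q)
    ≈⟨ interchange [ (a , + j) ] [ (b , + j) ] (indexed (suc j) P) (indexed (suc j) Q) ⟩
  ([ (a , + j) ] ++ indexed (suc j) P) ++ ([ (b , + j) ] ++ indexed (suc j) Q)  ∎
  where
  open SetoidReasoning (CommutativeRing.setoid laurentRing)
  interchange : ∀ w x y z → (w ++ x) ++ (y ++ z) ≈ (w ++ y) ++ (x ++ z)
  interchange = solve 4 (λ w x y z → ((w ⊕ x) ⊕ (y ⊕ z)) ⊜ ((w ⊕ y) ⊕ (x ⊕ z))) ≈-refl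

indexed-negᴾ : ∀ j P → indexed j (negᴾ P) ≡ negL (indexed j P)
indexed-negᴾ j []      = refl
indexed-negᴾ j (a ∷ P) = cong ((- a , + j) ∷_) (indexed-negᴾ (suc j) P)

coeff-indexed-suc : ∀ j P i → coeff (indexed (suc j) P) i ≡ coeff (indexed j P) (i - 1ℤ)
coeff-indexed-suc j []      i = refl
coeff-indexed-suc j (c ∷ P) i with + suc j ≟ i | + j ≟ i - 1ℤ
... | yes _ | yes _ = cong (_+_ c) (coeff-indexed-suc (suc j) P i)
... | yes 1+j≡i | no j≢i-1 = contradiction (x+y≡z⇒y≡z-x 1ℤ (+ j) i 1+j≡i) j≢i-1
... | no 1+j≢i | yes j≡i-1 = contradiction (y≡z-x⇒x+y≡z 1ℤ (+ j) i j≡i-1) 1+j≢i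
... | no _ | no _ = coeff-indexed-suc (suc j) P i

indexed-suc : ∀ j P → indexed (suc j) P ≈ monoL 1ℤ *ᴸ indexed j P
indexed-suc j P = mk≈ λ i →
  trans (coeff-indexed-suc j P i)
        (sym (trans (coeff-*ᴸ (monoL 1ℤ) (indexed j P) i)
                    (trans (ℤₚ.+-identityʳ _) (ℤₚ.*-identityˡ _))))

indexed-0∷ : ∀ j P → indexed j (0ℤ ∷ P) ≈ indexed (suc j) P
indexed-0∷ j P = mk≈ λ i →
  trans (coeff-∷ (0ℤ , + j) (indexed (suc j) P) i)
        (trans (cong (_+ coeff (indexed (suc j) P) i) (lemma i)) (ℤₚ.+-identityˡ _))
  where
  lemma : ∀ i → coeff [ (0ℤ , + j) ] i ≡ 0ℤ
  lemma i with + j ≟ i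
  ... | yes _ = refl
  ... | no  _ = refl

indexed-shiftᴾ : ∀ m j P → indexed j (shiftᴾ m P) ≈ monoL (+ m) *ᴸ indexed j P
indexed-shiftᴾ zero    j P = ≈-sym (*ᴸ-identityˡ (indexed j P))
indexed-shiftᴾ (suc m) j P =
  ≈-trans (indexed-0∷ j (shiftᴾ m P))
    (≈-trans (indexed-suc j (shiftᴾ m P))
      (≈-trans (*ᴸ-congˡ (monoL 1ℤ) (indexed-shiftᴾ m j P))
        (≈-sym (*ᴸ-assoc (monoL 1ℤ) (monoL (+ m)) (indexed j P)))))

-- Gaussian polynomials

qPoch : ℕ → ℕ → LPoly
qPoch s zero    = oneL
qPoch s (suc a) = oneMinus (+ suc s) *ᴸ qPoch (suc s) a

qPoch-+ : ∀ s a b → qPoch s (a ℕ.+ b) ≈ qPoch s a *ᴸ qPoch (s ℕ.+ a) b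
qPoch-+ s zero    b = ≈-trans (≡⇒≈ (cong (λ t → qPoch t b) (sym (ℕₚ.+-identityʳ s))))
                              (≈-sym (*ᴸ-identityˡ _))
qPoch-+ s (suc a) b =
  ≈-trans (*ᴸ-congˡ (oneMinus (+ suc s))
            (≈-trans (qPoch-+ (suc s) a b)
                     (≡⇒≈ (cong (λ t → qPoch (suc s) a *ᴸ qPoch t b) (sym (ℕₚ.+-suc s a))))))
          (≈-sym (*ᴸ-assoc (oneMinus (+ suc s)) (qPoch (suc s) a) _))

qPoch-suc : ∀ s a → qPoch s (suc a) ≈ qPoch s a *ᴸ oneMinus (+ suc (s ℕ.+ a))
qPoch-suc s a =
  ≈-trans (≡⇒≈ (cong (qPoch s) (ℕₚ.+-comm 1 a)))
    (≈-trans (qPoch-+ s a 1) (*ᴸ-congˡ (qPoch s a) (*ᴸ-identityʳ _)))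

-- gauss a b is the Gaussian binomial coefficient [a+b choose a]_q.
gauss : ℕ → ℕ → Poly
gauss zero    b       = 1ℤ ∷ []
gauss (suc a) zero    = 1ℤ ∷ []
gauss (suc a) (suc b) = gauss a (suc b) +ᴾ shiftᴾ (suc a) (gauss (suc a) b)

gauss-pascal : ∀ a b →
  toL (gauss (suc a) (suc b)) ≈ toL (gauss a (suc b)) ++ monoL (+ suc a) *ᴸ toL (gauss (suc a) b)
gauss-pascal a b =
  ≈-trans (indexed-+ᴾ 0 (gauss a (suc b)) _) (++-cong ≈-refl (indexed-shiftᴾ (suc a) 0 _))

gauss-product : ∀ a b → toL (gauss a b) *ᴸ qPoch 0 a ≈ qPoch b a
gauss-product zero    b       = *ᴸ-identityˡ oneL
gauss-product (suc a) zero    = *ᴸ-identityˡ (qPoch 0 (suc a))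
gauss-product (suc a) (suc b) = begin
  toL (gauss (suc a) (suc b)) *ᴸ qPoch 0 (suc a)
    ≈⟨ *ᴸ-cong (gauss-pascal a b) ≈-refl ⟩
  (g₁ ++ x *ᴸ g₂) *ᴸ qPoch 0 (suc a)
    ≈⟨ distrib g₁ g₂ x (qPoch 0 (suc a)) ⟩
  g₁ *ᴸ qPoch 0 (suc a) ++ x *ᴸ (g₂ *ᴸ qPoch 0 (suc a))
    ≈⟨ ++-cong (≈-trans (*ᴸ-congˡ g₁ (qPoch-suc 0 a)) (≈-sym (*ᴸ-assoc g₁ (qPoch 0 a) _)))
               (*ᴸ-congˡ x (gauss-product (suc a) b)) ⟩
  (g₁ *ᴸ qPoch 0 a) *ᴸ oneMinus (+ suc a) ++ x *ᴸ qPoch b (suc a)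
    ≈⟨ ++-cong (*ᴸ-cong (gauss-product a (suc b)) ≈-refl) ≈-refl ⟩
  Q *ᴸ oneMinus (+ suc a) ++ x *ᴸ (oneMinus (+ suc b) *ᴸ Q)
    ≈⟨ telescope Q x (monoL (+ suc b)) ⟩
  Q *ᴸ oneMinus (+ suc b + + suc a)
    ≈⟨ ≡⇒≈ (cong (λ t → Q *ᴸ oneMinus (+ t)) (ℕₚ.+-suc (suc b) a)) ⟩
  Q *ᴸ oneMinus (+ suc (suc b ℕ.+ a))
    ≈⟨ qPoch-suc (suc b) a ⟨
  qPoch (suc b) (suc a) ∎
  where
  open SetoidReasoning (CommutativeRing.setoid laurentRing)
  g₁ = toL (gauss a (suc b))
  g₂ = toL (gauss (suc a) b)
  x  = monoL (+ suc a)
  Q  = qPoch (suc b) a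
  distrib : ∀ u v x w → (u ++ x *ᴸ v) *ᴸ w ≈ u *ᴸ w ++ x *ᴸ (v *ᴸ w)
  distrib = solve 4 (λ u v x w → ((u ⊕ x ⊗ v) ⊗ w) ⊜ (u ⊗ w ⊕ x ⊗ (v ⊗ w))) ≈-refl
  telescope : ∀ Q x y → Q *ᴸ (oneL ++ negL x) ++ x *ᴸ ((oneL ++ negL y) *ᴸ Q)
                        ≈ Q *ᴸ (oneL ++ negL (y *ᴸ x))
  telescope = solve 3 (λ Q x y → (Q ⊗ (Κ oneL ⊕ ⊝ x) ⊕ x ⊗ ((Κ oneL ⊕ ⊝ y) ⊗ Q))
                                 ⊜ (Q ⊗ (Κ oneL ⊕ ⊝ (y ⊗ x)))) ≈-refl

+ᴾ-∷ʳ : ∀ P cs c → length P ℕ.≤ length cs → P +ᴾ (cs ∷ʳ c) ≡ (P +ᴾ cs) ∷ʳ c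
+ᴾ-∷ʳ []      cs       c _             = refl
+ᴾ-∷ʳ (a ∷ P) (b ∷ cs) c (ℕ.s≤s P≤cs) = cong ((a + b) ∷_) (+ᴾ-∷ʳ P cs c P≤cs)

length-+ᴾ : ∀ P cs → length P ℕ.≤ length cs → length (P +ᴾ cs) ≡ length cs
length-+ᴾ []      cs       _             = refl
length-+ᴾ (a ∷ P) (b ∷ cs) (ℕ.s≤s P≤cs) = cong suc (length-+ᴾ P cs P≤cs)

gauss-monic : ∀ a b → Σ Poly λ cs → (gauss a b ≡ cs ∷ʳ 1ℤ) × (length cs ≡ a ℕ.* b)
gauss-monic zero    b       = [] , refl , refl
gauss-monic (suc a) zero    = [] , refl , sym (ℕₚ.*-zeroʳ (suc a))
gauss-monic (suc a) (suc b) with gauss-monic a (suc b) | gauss-monic (suc a) b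
... | cs₁ , eq₁ , len₁ | cs₂ , eq₂ , len₂ =
  gauss a (suc b) +ᴾ R , eq , trans (length-+ᴾ (gauss a (suc b)) R shorter) (trans lenR (sym (ℕₚ.*-suc (suc a) b)))
  where
  R = replicate (suc a) 0ℤ ++ cs₂
  lenR : length R ≡ suc a ℕ.+ suc a ℕ.* b
  lenR = trans (Listₚ.length-++ (replicate (suc a) 0ℤ))
               (cong₂ ℕ._+_ (Listₚ.length-replicate (suc a)) len₂)
  shorter : length (gauss a (suc b)) ℕ.≤ length R
  shorter = begin
    length (gauss a (suc b))    ≡⟨ cong length eq₁ ⟩
    length (cs₁ ∷ʳ 1ℤ)          ≡⟨ Listₚ.length-++ cs₁ ⟩
    length cs₁ ℕ.+ 1            ≡⟨ cong (ℕ._+ 1) (trans len₁ (ℕₚ.*-suc a b)) ⟩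
    a ℕ.+ a ℕ.* b ℕ.+ 1         ≤⟨ ℕₚ.+-monoˡ-≤ 1 (ℕₚ.+-monoʳ-≤ a (ℕₚ.m≤n+m (a ℕ.* b) b)) ⟩
    a ℕ.+ (b ℕ.+ a ℕ.* b) ℕ.+ 1 ≡⟨ ℕₚ.+-comm _ 1 ⟩
    suc a ℕ.+ suc a ℕ.* b       ≡⟨ lenR ⟨
    length R                    ∎
    where open ℕₚ.≤-Reasoning
  eq : gauss (suc a) (suc b) ≡ (gauss a (suc b) +ᴾ R) ∷ʳ 1ℤ
  eq = trans (cong (λ P → gauss a (suc b) +ᴾ (replicate (suc a) 0ℤ ++ P)) eq₂)
             (trans (cong (gauss a (suc b) +ᴾ_) (sym (Listₚ.++-assoc (replicate (suc a) 0ℤ) cs₂ [ 1ℤ ])))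
                    (+ᴾ-∷ʳ (gauss a (suc b)) R 1ℤ shorter))

gauss-hasDegree : ∀ a b → HasDegree (gauss a b) (+ (a ℕ.* b))
gauss-hasDegree a b with gauss-monic a b
... | cs , eq , len = cs , 1ℤ , eq , (λ ()) , cong +_ len

-- Reciprocity

sign : ℕ → LPoly
sign zero    = oneL
sign (suc a) = negL (sign a)

sign-square : ∀ a → sign a *ᴸ sign a ≈ oneL
sign-square zero    = *ᴸ-identityˡ oneL
sign-square (suc a) = ≈-trans (negL-square (sign a)) (sign-square a)
  where
  negL-square : ∀ x → negL x *ᴸ negL x ≈ x *ᴸ x
  negL-square = solve 1 (λ x → (⊝ x ⊗ ⊝ x) ⊜ (x ⊗ x)) ≈-refl

sumFrom : ℕ → ℕ → ℕ
sumFrom s zero    = 0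
sumFrom s (suc a) = suc s ℕ.+ sumFrom (suc s) a

sumFrom-shift : ∀ s a → sumFrom s a ≡ a ℕ.* s ℕ.+ sumFrom 0 a
sumFrom-shift s zero    = refl
sumFrom-shift s (suc a) = begin
  suc s ℕ.+ sumFrom (suc s) a                    ≡⟨ cong (suc s ℕ.+_) (sumFrom-shift (suc s) a) ⟩
  suc s ℕ.+ (a ℕ.* suc s ℕ.+ sumFrom 0 a)        ≡⟨ lemma s a (sumFrom 0 a) ⟩
  suc a ℕ.* s ℕ.+ (1 ℕ.+ (a ℕ.* 1 ℕ.+ sumFrom 0 a))
                                                 ≡⟨ cong (λ t → suc a ℕ.* s ℕ.+ (1 ℕ.+ t)) (sumFrom-shift 1 a) ⟨
  suc a ℕ.* s ℕ.+ sumFrom 0 (suc a)              ∎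
  where
  open ≡-Reasoning
  lemma : ∀ s a t → suc s ℕ.+ (a ℕ.* suc s ℕ.+ t) ≡ suc a ℕ.* s ℕ.+ (1 ℕ.+ (a ℕ.* 1 ℕ.+ t))
  lemma = NatSolver.solve-∀

sumFrom-double : ∀ s a → sumFrom s a ℕ.+ sumFrom s a ≡ a ℕ.* (s ℕ.+ s ℕ.+ a ℕ.+ 1)
sumFrom-double s zero    = refl
sumFrom-double s (suc a) = begin
  (suc s ℕ.+ T) ℕ.+ (suc s ℕ.+ T)                       ≡⟨ regroup (suc s) T ⟩
  (suc s ℕ.+ suc s) ℕ.+ (T ℕ.+ T)                       ≡⟨ cong ((suc s ℕ.+ suc s) ℕ.+_) (sumFrom-double (suc s) a) ⟩
  (suc s ℕ.+ suc s) ℕ.+ a ℕ.* (suc s ℕ.+ suc s ℕ.+ a ℕ.+ 1) ≡⟨ expand s a ⟩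
  suc a ℕ.* (s ℕ.+ s ℕ.+ suc a ℕ.+ 1)                   ∎
  where
  open ≡-Reasoning
  T = sumFrom (suc s) a
  regroup : ∀ x t → (x ℕ.+ t) ℕ.+ (x ℕ.+ t) ≡ (x ℕ.+ x) ℕ.+ (t ℕ.+ t)
  regroup = NatSolver.solve-∀
  expand : ∀ s a → (suc s ℕ.+ suc s) ℕ.+ a ℕ.* (suc s ℕ.+ suc s ℕ.+ a ℕ.+ 1)
                   ≡ suc a ℕ.* (s ℕ.+ s ℕ.+ suc a ℕ.+ 1)
  expand = NatSolver.solve-∀

oneMinus-reciprocal : ∀ s → monoL (+ suc s) *ᴸ atInverse (oneMinus (+ suc s)) ≈ negL (oneMinus (+ suc s))
oneMinus-reciprocal s = begin
  x *ᴸ (oneL ++ negL y)   ≈⟨ expand x y ⟩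
  x ++ negL (x *ᴸ y)      ≈⟨ ++-cong (≈-refl {x}) (negL-cong (≡⇒≈ (cong monoL (ℤₚ.+-inverseʳ (+ suc s))))) ⟩
  x ++ negL oneL          ≈⟨ rearrange x ⟩
  negL (oneL ++ negL x)   ∎
  where
  open SetoidReasoning (CommutativeRing.setoid laurentRing)
  x = monoL (+ suc s)
  y = monoL -[1+ s ]
  expand : ∀ x y → x *ᴸ (oneL ++ negL y) ≈ x ++ negL (x *ᴸ y)
  expand = solve 2 (λ x y → (x ⊗ (Κ oneL ⊕ ⊝ y)) ⊜ (x ⊕ ⊝ (x ⊗ y))) ≈-refl
  rearrange : ∀ x → x ++ negL oneL ≈ negL (oneL ++ negL x)
  rearrange = solve 1 (λ x → (x ⊕ ⊝ Κ oneL) ⊜ (⊝ (Κ oneL ⊕ ⊝ x))) ≈-refl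

qPoch-reciprocal : ∀ s a → monoL (+ sumFrom s a) *ᴸ atInverse (qPoch s a) ≈ sign a *ᴸ qPoch s a
qPoch-reciprocal s zero    = ≈-refl
qPoch-reciprocal s (suc a) = begin
  (x *ᴸ t) *ᴸ atInverse (X *ᴸ Q)          ≈⟨ *ᴸ-congˡ (x *ᴸ t) (atInverse-*ᴸ X Q) ⟩
  (x *ᴸ t) *ᴸ (atInverse X *ᴸ atInverse Q) ≈⟨ *ᴸ-interchange x t (atInverse X) (atInverse Q) ⟩
  (x *ᴸ atInverse X) *ᴸ (t *ᴸ atInverse Q) ≈⟨ *ᴸ-cong (oneMinus-reciprocal s) (qPoch-reciprocal (suc s) a) ⟩
  negL X *ᴸ (sign a *ᴸ Q)                  ≈⟨ pullSign X (sign a) Q ⟩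
  negL (sign a) *ᴸ (X *ᴸ Q)                ∎
  where
  open SetoidReasoning (CommutativeRing.setoid laurentRing)
  x = monoL (+ suc s)
  t = monoL (+ sumFrom (suc s) a)
  X = oneMinus (+ suc s)
  Q = qPoch (suc s) a
  pullSign : ∀ X σ Q → negL X *ᴸ (σ *ᴸ Q) ≈ negL σ *ᴸ (X *ᴸ Q)
  pullSign = solve 3 (λ X σ Q → (⊝ X ⊗ (σ ⊗ Q)) ⊜ (⊝ σ ⊗ (X ⊗ Q))) ≈-refl

atInverse-qPoch : ∀ s a → atInverse (qPoch s a) ≈ monoL (- + sumFrom s a) *ᴸ (sign a *ᴸ qPoch s a)
atInverse-qPoch s a = begin
  atInverse (qPoch s a)                ≈⟨ *ᴸ-identityˡ _ ⟨
  oneL *ᴸ atInverse (qPoch s a)        ≈⟨ *ᴸ-cong (≡⇒≈ (cong monoL (sym (ℤₚ.+-inverseˡ (+ sumFrom s a))))) ≈-refl ⟩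
  (t⁻ *ᴸ t) *ᴸ atInverse (qPoch s a)   ≈⟨ *ᴸ-assoc t⁻ t _ ⟩
  t⁻ *ᴸ (t *ᴸ atInverse (qPoch s a))   ≈⟨ *ᴸ-congˡ t⁻ (qPoch-reciprocal s a) ⟩
  t⁻ *ᴸ (sign a *ᴸ qPoch s a)          ∎
  where
  open SetoidReasoning (CommutativeRing.setoid laurentRing)
  t  = monoL (+ sumFrom s a)
  t⁻ = monoL (- + sumFrom s a)

expBound : LPoly → ℕ
expBound []            = 0
expBound ((_ , e) ∷ p) = ∣ e ∣ ℕ.+ expBound p

coeff-beyond : ∀ p i → expBound p ℕ.< ∣ i ∣ → coeff p i ≡ 0ℤ
coeff-beyond []            i _     = refl
coeff-beyond ((c , e) ∷ p) i B<∣i∣ with e ≟ i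
... | yes refl = contradiction B<∣i∣ (ℕₚ.≤⇒≯ (ℕₚ.m≤m+n ∣ e ∣ _))
... | no  _    = coeff-beyond p i (ℕₚ.≤-<-trans (ℕₚ.m≤n+m _ ∣ e ∣) B<∣i∣)

-- Multiplication by 1 - q^k makes the coefficients k-periodic; having
-- finite support, they must all vanish.
oneMinus-*ᴸ≈[] : ∀ k p → oneMinus (+ suc k) *ᴸ p ≈ [] → p ≈ []
oneMinus-*ᴸ≈[] k p (mk≈ annihilated) = mk≈ λ i →
  trans (periodic (N i) i) (coeff-beyond p _ (far i))
  where
  κ = + suc k
  B = expBound p

  N : ℤ → ℕ
  N i = suc (B ℕ.+ ∣ i ∣)

  difference : ∀ a b → a - b ≡ 1ℤ * a + (-1ℤ * b + 0ℤ)
  difference = solve-∀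

  step : ∀ j → coeff p j ≡ coeff p (j - κ)
  step j = trans (cong (coeff p) (sym (ℤₚ.+-identityʳ j)))
                 (ℤₚ.i-j≡0⇒i≡j _ _ (trans (difference (coeff p (j - 0ℤ)) (coeff p (j - κ)))
                                          (trans (sym (coeff-*ᴸ (oneMinus κ) p j)) (annihilated j))))

  shift-suc : ∀ j x c → j - x * c - c ≡ j - (1ℤ + x) * c
  shift-suc = solve-∀

  periodic : ∀ n j → coeff p j ≡ coeff p (j - + n * κ)
  periodic zero    j = cong (coeff p) (sym (ℤₚ.+-identityʳ j))
  periodic (suc n) j = trans (periodic n j) (trans (step _) (cong (coeff p) (shift-suc j (+ n) κ)))

  far : ∀ i → B ℕ.< ∣ i - + N i * κ ∣
  far i = ℕₚ.+-cancelˡ-≤ ∣ i ∣ (suc B) _ (begin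
    ∣ i ∣ ℕ.+ suc B         ≡⟨ trans (ℕₚ.+-suc ∣ i ∣ B) (cong suc (ℕₚ.+-comm ∣ i ∣ B)) ⟩
    N i                     ≤⟨ ℕₚ.m≤m*n (N i) (suc k) ⟩
    N i ℕ.* suc k           ≡⟨ ℤₚ.abs-* (+ N i) κ ⟨
    ∣ y ∣                   ≡⟨ cong ∣_∣ (d-[d-e]≡e i y) ⟨
    ∣ i - (i - y) ∣         ≤⟨ ℤₚ.∣i-j∣≤∣i∣+∣j∣ i (i - y) ⟩
    ∣ i ∣ ℕ.+ ∣ i - y ∣     ∎)
    where
    open ℕₚ.≤-Reasoning
    y = + N i * κ

*ᴸ-cancelʳ-oneMinus : ∀ k {p r} → p *ᴸ oneMinus (+ suc k) ≈ r *ᴸ oneMinus (+ suc k) → p ≈ r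
*ᴸ-cancelʳ-oneMinus k {p} {r} pX≈rX = begin
  p                  ≈⟨ split p r ⟩
  (p ++ negL r) ++ r ≈⟨ ++-cong (oneMinus-*ᴸ≈[] k (p ++ negL r) annihilated) (≈-refl {r}) ⟩
  [] ++ r            ∎
  where
  open SetoidReasoning (CommutativeRing.setoid laurentRing)
  X = oneMinus (+ suc k)
  split : ∀ p r → p ≈ (p ++ negL r) ++ r
  split = solve 2 (λ p r → p ⊜ ((p ⊕ ⊝ r) ⊕ r)) ≈-refl
  difference : ∀ X p r → X *ᴸ (p ++ negL r) ≈ p *ᴸ X ++ negL (r *ᴸ X)
  difference = solve 3 (λ X p r → (X ⊗ (p ⊕ ⊝ r)) ⊜ (p ⊗ X ⊕ ⊝ (r ⊗ X))) ≈-refl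
  annihilated : X *ᴸ (p ++ negL r) ≈ []
  annihilated = ≈-trans (difference X p r)
    (≈-trans (++-cong pX≈rX (≈-refl {negL (r *ᴸ X)}))
             (≈-trans (++-comm (r *ᴸ X) _) (negL-inverseˡ (r *ᴸ X))))

*ᴸ-cancelʳ-qPoch : ∀ s a {p r} → p *ᴸ qPoch s a ≈ r *ᴸ qPoch s a → p ≈ r
*ᴸ-cancelʳ-qPoch s zero    {p} {r} eq = ≈-trans (≈-sym (*ᴸ-identityʳ p)) (≈-trans eq (*ᴸ-identityʳ r))
*ᴸ-cancelʳ-qPoch s (suc a) {p} {r} eq =
  *ᴸ-cancelʳ-oneMinus s (*ᴸ-cancelʳ-qPoch (suc s) a
    (≈-trans (*ᴸ-assoc p X Q) (≈-trans eq (≈-sym (*ᴸ-assoc r X Q)))))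
  where
  X = oneMinus (+ suc s)
  Q = qPoch (suc s) a

-- Substituting q ↦ q⁻¹ into  gauss a b · qPoch 0 a = qPoch b a  and
-- applying qPoch-reciprocal to both q-Pochhammer products.
gauss-reciprocal : ∀ a b → monoL (+ (a ℕ.* b)) *ᴸ atInverse (toL (gauss a b)) ≈ toL (gauss a b)
gauss-reciprocal a b = *ᴸ-cancelʳ-qPoch 0 a (begin
  (m *ᴸ g⁻) *ᴸ F                          ≈⟨ *ᴸ-identityˡ _ ⟨
  oneL *ᴸ ((m *ᴸ g⁻) *ᴸ F)                ≈⟨ *ᴸ-cong (sign-square a) ≈-refl ⟨
  (σ *ᴸ σ) *ᴸ ((m *ᴸ g⁻) *ᴸ F)            ≈⟨ regroup σ m g⁻ F ⟩
  σ *ᴸ ((m *ᴸ g⁻) *ᴸ (σ *ᴸ F))            ≈⟨ *ᴸ-congˡ σ (*ᴸ-congˡ (m *ᴸ g⁻) (qPoch-reciprocal 0 a)) ⟨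
  σ *ᴸ ((m *ᴸ g⁻) *ᴸ (t₀ *ᴸ F⁻))          ≈⟨ *ᴸ-congˡ σ (*ᴸ-interchange m g⁻ t₀ F⁻) ⟩
  σ *ᴸ ((m *ᴸ t₀) *ᴸ (g⁻ *ᴸ F⁻))          ≈⟨ *ᴸ-congˡ σ (*ᴸ-cong exponent product⁻) ⟩
  σ *ᴸ (monoL (+ sumFrom b a) *ᴸ atInverse (qPoch b a))
                                          ≈⟨ *ᴸ-congˡ σ (qPoch-reciprocal b a) ⟩
  σ *ᴸ (σ *ᴸ qPoch b a)                   ≈⟨ *ᴸ-assoc σ σ _ ⟨
  (σ *ᴸ σ) *ᴸ qPoch b a                   ≈⟨ *ᴸ-cong (sign-square a) ≈-refl ⟩
  oneL *ᴸ qPoch b a                       ≈⟨ *ᴸ-identityˡ _ ⟩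
  qPoch b a                               ≈⟨ gauss-product a b ⟨
  g *ᴸ F                                  ∎)
  where
  open SetoidReasoning (CommutativeRing.setoid laurentRing)
  g  = toL (gauss a b)
  g⁻ = atInverse g
  F  = qPoch 0 a
  F⁻ = atInverse F
  σ  = sign a
  m  = monoL (+ (a ℕ.* b))
  t₀ = monoL (+ sumFrom 0 a)
  exponent : m *ᴸ t₀ ≈ monoL (+ sumFrom b a)
  exponent = ≡⇒≈ (cong (λ e → monoL (+ e)) (sym (sumFrom-shift b a)))
  product⁻ : g⁻ *ᴸ F⁻ ≈ atInverse (qPoch b a)
  product⁻ = ≈-trans (≈-sym (atInverse-*ᴸ g F)) (atInverse-cong (gauss-product a b))
  regroup : ∀ σ m g F → (σ *ᴸ σ) *ᴸ ((m *ᴸ g) *ᴸ F) ≈ σ *ᴸ ((m *ᴸ g) *ᴸ (σ *ᴸ F))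
  regroup = solve 4 (λ σ m g F → ((σ ⊗ σ) ⊗ ((m ⊗ g) ⊗ F)) ⊜ (σ ⊗ ((m ⊗ g) ⊗ (σ ⊗ F)))) ≈-refl

gauss-selfReciprocal : ∀ a b → SelfReciprocal (+ (a ℕ.* b)) (gauss a b)
gauss-selfReciprocal a b = coeff-≡ (≈-trans (reciprocalL≈ (+ (a ℕ.* b)) (gauss a b)) (gauss-reciprocal a b))

signᴾ : ℕ → Poly → Poly
signᴾ zero    P = P
signᴾ (suc a) P = negᴾ (signᴾ a P)

toL-signᴾ : ∀ a P → toL (signᴾ a P) ≈ sign a *ᴸ toL P
toL-signᴾ zero    P = ≈-sym (*ᴸ-identityˡ (toL P))
toL-signᴾ (suc a) P =
  ≈-trans (≡⇒≈ (indexed-negᴾ 0 (signᴾ a P)))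
    (≈-trans (negL-cong (toL-signᴾ a P)) (negL-*ᴸ (sign a) (toL P)))
  where
  negL-*ᴸ : ∀ x y → negL (x *ᴸ y) ≈ negL x *ᴸ y
  negL-*ᴸ = solve 2 (λ x y → (⊝ (x ⊗ y)) ⊜ (⊝ x ⊗ y)) ≈-refl

HasDegree-negᴾ : ∀ {P d} → HasDegree P d → HasDegree (negᴾ P) d
HasDegree-negᴾ (cs , c , refl , c≢0 , len) =
  negᴾ cs , - c , Listₚ.map-++ _ cs [ c ] ,
  (λ -c≡0 → c≢0 (trans (sym (ℤₚ.neg-involutive c)) (cong -_ -c≡0))) ,
  trans (cong +_ (Listₚ.length-map _ cs)) len

SelfReciprocal-negᴾ : ∀ {d P} → SelfReciprocal d P → SelfReciprocal d (negᴾ P)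
SelfReciprocal-negᴾ {d} {P} selfRecip i = begin
  coeff (reciprocalL d (negᴾ P)) i   ≡⟨ coeff-reciprocalL d (negᴾ P) i ⟩
  coeff (toL (negᴾ P)) (d - i)       ≡⟨ coeff-toL-negᴾ (d - i) ⟩
  - coeff (toL P) (d - i)            ≡⟨ cong -_ (coeff-reciprocalL d P i) ⟨
  - coeff (reciprocalL d P) i        ≡⟨ cong -_ (selfRecip i) ⟩
  - coeff (toL P) i                  ≡⟨ coeff-toL-negᴾ i ⟨
  coeff (toL (negᴾ P)) i             ∎
  where
  open ≡-Reasoning
  coeff-toL-negᴾ : ∀ j → coeff (toL (negᴾ P)) j ≡ - coeff (toL P) j
  coeff-toL-negᴾ j = trans (cong (λ L → coeff L j) (indexed-negᴾ 0 P)) (coeff-negL (toL P) j)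

signᴾ-preserves : ∀ s {P d} → HasDegree P d × SelfReciprocal d P →
                  HasDegree (signᴾ s P) d × SelfReciprocal d (signᴾ s P)
signᴾ-preserves zero    P-ok = P-ok
signᴾ-preserves (suc s) {P} {d} P-ok with signᴾ-preserves s P-ok
... | deg , selfRecip = HasDegree-negᴾ deg , SelfReciprocal-negᴾ {d} {signᴾ s P} selfRecip

-- The limit a → q

-- The factors fs contribute (1 - a/q)^order, times N / D at a = q.
record Evaluates (fs : List Factor) (order : ℤ) (N D : LPoly) : Set where
  field
    poleExp≡ : poleExp fs ≡ order
    num≈     : num (regularValue fs) ≈ N
    den≈     : den (regularValue fs) ≈ D
open Evaluates

poleExp-++ : ∀ xs ys → poleExp (xs ++ ys) ≡ poleExp xs + poleExp ys
poleExp-++ []             ys = sym (ℤₚ.+-identityˡ _)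
poleExp-++ ((m , e) ∷ xs) ys with m ≟ -1ℤ
... | yes _ = trans (cong (_+_ e) (poleExp-++ xs ys)) (sym (ℤₚ.+-assoc e (poleExp xs) (poleExp ys)))
... | no  _ = poleExp-++ xs ys

poleExp-invF : ∀ fs → poleExp (invF fs) ≡ - poleExp fs
poleExp-invF []             = refl
poleExp-invF ((m , e) ∷ fs) with m ≟ -1ℤ
... | yes _ = trans (cong (_+_ (- e)) (poleExp-invF fs)) (sym (ℤₚ.neg-distrib-+ e (poleExp fs)))
... | no  _ = poleExp-invF fs

regularValue-++ : ∀ xs ys →
  num (regularValue (xs ++ ys)) ≈ num (regularValue xs) *ᴸ num (regularValue ys) ×
  den (regularValue (xs ++ ys)) ≈ den (regularValue xs) *ᴸ den (regularValue ys)
regularValue-++ []             ys = ≈-sym (*ᴸ-identityˡ _) , ≈-sym (*ᴸ-identityˡ _)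
regularValue-++ ((m , e) ∷ xs) ys with m ≟ -1ℤ | regularValue-++ xs ys
... | yes _ | IH = IH
... | no  _ | N≈ , D≈ with e
...   | + j      = ≈-trans (*ᴸ-congˡ X^j N≈) (≈-sym (*ᴸ-assoc X^j (num (regularValue xs)) _)) , D≈
  where X^j = powL (oneMinus (m + 1ℤ)) j
...   | -[1+ j ] = N≈ , ≈-trans (*ᴸ-congˡ X^j D≈) (≈-sym (*ᴸ-assoc X^j (den (regularValue xs)) _))
  where X^j = powL (oneMinus (m + 1ℤ)) (suc j)

regularValue-invF : ∀ fs →
  num (regularValue (invF fs)) ≈ den (regularValue fs) ×
  den (regularValue (invF fs)) ≈ num (regularValue fs)
regularValue-invF []             = ≈-refl , ≈-refl
regularValue-invF ((m , e) ∷ fs) with m ≟ -1ℤ | regularValue-invF fs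
... | yes _ | IH = IH
... | no  _ | N≈ , D≈ with e
...   | + zero    = ≈-trans (*ᴸ-identityˡ _) N≈ , ≈-trans D≈ (≈-sym (*ᴸ-identityˡ _))
...   | + suc j   = N≈ , *ᴸ-congˡ (powL (oneMinus (m + 1ℤ)) (suc j)) D≈
...   | -[1+ j ]  = *ᴸ-congˡ (powL (oneMinus (m + 1ℤ)) (suc j)) N≈ , D≈

evaluates-++ : ∀ {xs ys o o′ N N′ D D′} → Evaluates xs o N D → Evaluates ys o′ N′ D′ →
               Evaluates (xs ++ ys) (o + o′) (N *ᴸ N′) (D *ᴸ D′)
evaluates-++ {xs} {ys} E E′ = record
  { poleExp≡ = trans (poleExp-++ xs ys) (cong₂ _+_ (poleExp≡ E) (poleExp≡ E′))
  ; num≈     = ≈-trans (proj₁ (regularValue-++ xs ys)) (*ᴸ-cong (num≈ E) (num≈ E′))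
  ; den≈     = ≈-trans (proj₂ (regularValue-++ xs ys)) (*ᴸ-cong (den≈ E) (den≈ E′))
  }

evaluates-invF : ∀ {fs o N D} → Evaluates fs o N D → Evaluates (invF fs) (- o) D N
evaluates-invF {fs} E = record
  { poleExp≡ = trans (poleExp-invF fs) (cong -_ (poleExp≡ E))
  ; num≈     = ≈-trans (proj₁ (regularValue-invF fs)) (den≈ E)
  ; den≈     = ≈-trans (proj₂ (regularValue-invF fs)) (num≈ E)
  }

evaluates-ascending : ∀ s n → Evaluates (map (λ j → (+ j , 1ℤ)) (iterate suc s n)) 0ℤ (qPoch s n) oneL
evaluates-ascending s zero    = record { poleExp≡ = refl ; num≈ = ≈-refl ; den≈ = ≈-refl }
evaluates-ascending s (suc n) = record
  { poleExp≡ = poleExp≡ E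
  ; num≈     = *ᴸ-cong (≈-trans (*ᴸ-identityʳ (oneMinus (+ s + 1ℤ))) (≡⇒≈ (cong (λ t → oneMinus (+ t)) (ℕₚ.+-comm s 1))))
                       (num≈ E)
  ; den≈     = den≈ E
  }
  where E = evaluates-ascending (suc s) n

evaluates-descending : ∀ s n →
  Evaluates (map (λ j → (- (+ suc j) , -1ℤ)) (iterate suc (suc s) n)) 0ℤ oneL (atInverse (qPoch s n))
evaluates-descending s zero    = record { poleExp≡ = refl ; num≈ = ≈-refl ; den≈ = ≈-refl }
evaluates-descending s (suc n) = record
  { poleExp≡ = poleExp≡ E
  ; num≈     = num≈ E
  ; den≈     = ≈-trans (*ᴸ-cong (*ᴸ-identityʳ (oneMinus -[1+ s ])) (den≈ E))
                       (≈-sym (atInverse-*ᴸ (oneMinus (+ suc s)) (qPoch (suc s) n)))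
  }
  where E = evaluates-descending (suc s) n

applyUpTo≡iterate : ∀ (f : ℕ → ℕ) s n → (∀ j → f j ≡ s ℕ.+ j) → applyUpTo f n ≡ iterate suc s n
applyUpTo≡iterate f s zero    _     = refl
applyUpTo≡iterate f s (suc n) f≗s+ =
  cong₂ _∷_ (trans (f≗s+ 0) (ℕₚ.+-identityʳ s))
            (applyUpTo≡iterate (λ j → f (suc j)) (suc s) n (λ j → trans (f≗s+ (suc j)) (ℕₚ.+-suc s j)))

evaluates-poch-+ : ∀ n → Evaluates (poch (+ n)) 0ℤ (qPoch 0 n) oneL
evaluates-poch-+ n =
  subst (λ js → Evaluates (map (λ j → (+ j , 1ℤ)) js) 0ℤ (qPoch 0 n) oneL)
        (sym (applyUpTo≡iterate (λ j → j) 0 n (λ _ → refl))) (evaluates-ascending 0 n)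

evaluates-poch-[1+] : ∀ a → Evaluates (poch -[1+ a ]) -1ℤ oneL (atInverse (qPoch 0 a))
evaluates-poch-[1+] a = record
  { poleExp≡ = cong (_+_ -1ℤ) (poleExp≡ E)
  ; num≈     = num≈ E
  ; den≈     = den≈ E
  }
  where
  E : Evaluates (map (λ j → (- (+ suc j) , -1ℤ)) (applyUpTo suc a)) 0ℤ oneL (atInverse (qPoch 0 a))
  E = subst (λ js → Evaluates (map (λ j → (- (+ suc j) , -1ℤ)) js) 0ℤ oneL (atInverse (qPoch 0 a)))
            (sym (applyUpTo≡iterate suc 1 a (λ _ → refl))) (evaluates-descending 0 a)

evaluates-binomFactors : ∀ {n k j o₁ o₂ o₃ N₁ N₂ N₃ D₁ D₂ D₃} → n - k ≡ j →
  Evaluates (poch n) o₁ N₁ D₁ → Evaluates (poch k) o₂ N₂ D₂ → Evaluates (poch j) o₃ N₃ D₃ →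
  Evaluates (binomFactors n k) (o₁ + (- o₂ + - o₃)) (N₁ *ᴸ (D₂ *ᴸ D₃)) (D₁ *ᴸ (N₂ *ᴸ N₃))
evaluates-binomFactors refl E₁ E₂ E₃ =
  evaluates-++ E₁ (evaluates-++ (evaluates-invF E₂) (evaluates-invF E₃))

limAtQ-regular : ∀ fs → poleExp fs ≡ 0ℤ → limAtQ fs ≡ just (regularValue fs)
limAtQ-regular fs order≡0 with poleExp fs
limAtQ-regular fs refl | .(+ zero) = refl

qbinom-monoTimesSelfRecip : ∀ {n k N D} e P d → Evaluates (binomFactors n k) 0ℤ N D →
  N ≈ (monoL e *ᴸ toL P) *ᴸ D → HasDegree P d × SelfReciprocal d P →
  MonoTimesSelfRecip (qbinom n k) e d
qbinom-monoTimesSelfRecip {n} {k} e P d E N≈ (deg , selfRecip) =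
  P , deg , selfRecip , regularValue (binomFactors n k) ,
  limAtQ-regular (binomFactors n k) (poleExp≡ E) ,
  coeff-≡ (≈-trans (num≈ E) (≈-trans N≈ (*ᴸ-congˡ (monoL e *ᴸ toL P) (≈-sym (den≈ E)))))

/ℕ2-neg : ∀ n → suc n ℕ.% 2 ≡ 0 → -[1+ n ] /ℕ 2 ≡ - + (suc n ℕ./ 2)
/ℕ2-neg n even with suc n ℕ.% 2
/ℕ2-neg n refl | .0 = refl

m+m≡m*2 : ∀ m → m ℕ.+ m ≡ m ℕ.* 2
m+m≡m*2 = NatSolver.solve-∀

half-double : ∀ z → half (z + z) ≡ z
half-double (+ m) =
  trans (ℤₚ.*-identityˡ _) (cong +_ (trans (cong (ℕ._/ 2) (m+m≡m*2 m)) (m*n/n≡m m 2)))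
half-double -[1+ m ] =
  trans (ℤₚ.*-identityˡ _)
    (trans (/ℕ2-neg (suc (m ℕ.+ m)) (trans (cong (ℕ._% 2) double) (m*n%n≡0 (suc m) 2)))
           (cong (λ t → - + t) (trans (cong (ℕ._/ 2) double) (m*n/n≡m (suc m) 2))))
  where
  double : suc (suc (m ℕ.+ m)) ≡ suc m ℕ.* 2
  double = cong (λ t → suc (suc t)) (m+m≡m*2 m)

half-neg-sumFrom : ∀ s a → half (- (+ a * (+ s + + s + + a + 1ℤ))) ≡ - + sumFrom s a
half-neg-sumFrom s a = begin
  half (- (+ a * (+ s + + s + + a + 1ℤ)))   ≡⟨ cong (λ z → half (- z)) (ℤₚ.pos-* a _) ⟨
  half (- + (a ℕ.* (s ℕ.+ s ℕ.+ a ℕ.+ 1)))  ≡⟨ cong (λ t → half (- + t)) (sumFrom-double s a) ⟨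
  half (- (+ sumFrom s a + + sumFrom s a))  ≡⟨ cong half (ℤₚ.neg-distrib-+ (+ sumFrom s a) _) ⟩
  half (- + sumFrom s a + - + sumFrom s a)  ≡⟨ half-double (- + sumFrom s a) ⟩
  - + sumFrom s a                           ∎
  where open ≡-Reasoning

atInverse-qPoch-+ : ∀ a c → atInverse (qPoch 0 (a ℕ.+ c)) ≈
  atInverse (qPoch 0 a) *ᴸ (monoL (- + sumFrom a c) *ᴸ (toL (signᴾ c (gauss c a)) *ᴸ qPoch 0 c))
atInverse-qPoch-+ a c = begin
  atInverse (qPoch 0 (a ℕ.+ c))                   ≈⟨ atInverse-cong (qPoch-+ 0 a c) ⟩
  atInverse (qPoch 0 a *ᴸ qPoch a c)              ≈⟨ atInverse-*ᴸ (qPoch 0 a) (qPoch a c) ⟩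
  F⁻ *ᴸ atInverse (qPoch a c)                     ≈⟨ *ᴸ-congˡ F⁻ (atInverse-qPoch a c) ⟩
  F⁻ *ᴸ (t⁻ *ᴸ (sign c *ᴸ qPoch a c))             ≈⟨ *ᴸ-congˡ F⁻ (*ᴸ-congˡ t⁻ signed-product) ⟩
  F⁻ *ᴸ (t⁻ *ᴸ (toL (signᴾ c (gauss c a)) *ᴸ F))  ∎
  where
  open SetoidReasoning (CommutativeRing.setoid laurentRing)
  F  = qPoch 0 c
  F⁻ = atInverse (qPoch 0 a)
  t⁻ = monoL (- + sumFrom a c)
  signed-product : sign c *ᴸ qPoch a c ≈ toL (signᴾ c (gauss c a)) *ᴸ F
  signed-product = ≈-trans (*ᴸ-congˡ (sign c) (≈-sym (gauss-product c a)))
    (≈-trans (≈-sym (*ᴸ-assoc (sign c) (toL (gauss c a)) F))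
             (*ᴸ-cong (≈-sym (toL-signᴾ c (gauss c a))) ≈-refl))

qbinom-+-+ : ∀ k l → MonoTimesSelfRecip (qbinom (+ (k ℕ.+ l)) (+ k)) 0ℤ (+ (l ℕ.* k))
qbinom-+-+ k l = qbinom-monoTimesSelfRecip {+ (k ℕ.+ l)} {+ k} 0ℤ (gauss l k) (+ (l ℕ.* k)) E numerator
                 (gauss-hasDegree l k , gauss-selfReciprocal l k)
  where
  open SetoidReasoning (CommutativeRing.setoid laurentRing)
  x+y-x≡y : ∀ x y → (x + y) - x ≡ y
  x+y-x≡y = solve-∀
  E = evaluates-binomFactors {+ (k ℕ.+ l)} {+ k} (x+y-x≡y (+ k) (+ l))
        (evaluates-poch-+ (k ℕ.+ l)) (evaluates-poch-+ k) (evaluates-poch-+ l)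
  F = qPoch 0 k
  G = toL (gauss l k)
  rearrange : ∀ F G F′ → (F *ᴸ (G *ᴸ F′)) *ᴸ (oneL *ᴸ oneL) ≈ (oneL *ᴸ G) *ᴸ (oneL *ᴸ (F *ᴸ F′))
  rearrange = solve 3 (λ F G F′ → ((F ⊗ (G ⊗ F′)) ⊗ (Κ oneL ⊗ Κ oneL))
                                  ⊜ ((Κ oneL ⊗ G) ⊗ (Κ oneL ⊗ (F ⊗ F′)))) ≈-refl
  numerator : qPoch 0 (k ℕ.+ l) *ᴸ (oneL *ᴸ oneL) ≈ (oneL *ᴸ G) *ᴸ (oneL *ᴸ (F *ᴸ qPoch 0 l))
  numerator = begin
    qPoch 0 (k ℕ.+ l) *ᴸ (oneL *ᴸ oneL)          ≈⟨ *ᴸ-cong (qPoch-+ 0 k l) ≈-refl ⟩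
    (F *ᴸ qPoch k l) *ᴸ (oneL *ᴸ oneL)           ≈⟨ *ᴸ-cong (*ᴸ-congˡ F (gauss-product l k)) ≈-refl ⟨
    (F *ᴸ (G *ᴸ qPoch 0 l)) *ᴸ (oneL *ᴸ oneL)    ≈⟨ rearrange F G (qPoch 0 l) ⟩
    (oneL *ᴸ G) *ᴸ (oneL *ᴸ (F *ᴸ qPoch 0 l))    ∎

qbinom-[1+]-+ : ∀ a c → MonoTimesSelfRecip (qbinom -[1+ a ] (+ c)) (- + sumFrom a c) (+ (c ℕ.* a))
qbinom-[1+]-+ a c = qbinom-monoTimesSelfRecip { -[1+ a ]} {+ c} (- + sumFrom a c) (signᴾ c (gauss c a)) (+ (c ℕ.* a))
                      E numerator (signᴾ-preserves c (gauss-hasDegree c a , gauss-selfReciprocal c a))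
  where
  difference : ∀ y x → - (1ℤ + y) - x ≡ - (1ℤ + (y + x))
  difference = solve-∀
  E = evaluates-binomFactors { -[1+ a ]} {+ c} (difference (+ a) (+ c))
        (evaluates-poch-[1+] a) (evaluates-poch-+ c) (evaluates-poch-[1+] (a ℕ.+ c))
  rearrange : ∀ F⁻ t P F → oneL *ᴸ (oneL *ᴸ (F⁻ *ᴸ (t *ᴸ (P *ᴸ F)))) ≈ (t *ᴸ P) *ᴸ (F⁻ *ᴸ (F *ᴸ oneL))
  rearrange = solve 4 (λ F⁻ t P F → (Κ oneL ⊗ (Κ oneL ⊗ (F⁻ ⊗ (t ⊗ (P ⊗ F)))))
                                    ⊜ ((t ⊗ P) ⊗ (F⁻ ⊗ (F ⊗ Κ oneL)))) ≈-refl
  numerator = ≈-trans (*ᴸ-congˡ oneL (*ᴸ-congˡ oneL (atInverse-qPoch-+ a c)))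
                      (rearrange (atInverse (qPoch 0 a)) (monoL (- + sumFrom a c))
                                 (toL (signᴾ c (gauss c a))) (qPoch 0 c))

qbinom-[1+]-[1+] : ∀ a c →
  MonoTimesSelfRecip (qbinom -[1+ a ] -[1+ (a ℕ.+ c) ]) (- + sumFrom a c) (+ (c ℕ.* a))
qbinom-[1+]-[1+] a c = qbinom-monoTimesSelfRecip { -[1+ a ]} { -[1+ (a ℕ.+ c) ]} (- + sumFrom a c) (signᴾ c (gauss c a)) (+ (c ℕ.* a))
                         E numerator (signᴾ-preserves c (gauss-hasDegree c a , gauss-selfReciprocal c a))
  where
  difference : ∀ y x → - (1ℤ + y) - - (1ℤ + (y + x)) ≡ x
  difference = solve-∀
  E = evaluates-binomFactors { -[1+ a ]} { -[1+ (a ℕ.+ c) ]} (difference (+ a) (+ c))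
        (evaluates-poch-[1+] a) (evaluates-poch-[1+] (a ℕ.+ c)) (evaluates-poch-+ c)
  rearrange : ∀ F⁻ t P F → oneL *ᴸ ((F⁻ *ᴸ (t *ᴸ (P *ᴸ F))) *ᴸ oneL) ≈ (t *ᴸ P) *ᴸ (F⁻ *ᴸ (oneL *ᴸ F))
  rearrange = solve 4 (λ F⁻ t P F → (Κ oneL ⊗ ((F⁻ ⊗ (t ⊗ (P ⊗ F))) ⊗ Κ oneL))
                                    ⊜ ((t ⊗ P) ⊗ (F⁻ ⊗ (Κ oneL ⊗ F)))) ≈-refl
  numerator = ≈-trans (*ᴸ-congˡ oneL (*ᴸ-cong (atInverse-qPoch-+ a c) (≈-refl {oneL})))
                      (rearrange (atInverse (qPoch 0 a)) (monoL (- + sumFrom a c))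
                                 (toL (signᴾ c (gauss c a))) (qPoch 0 c))

qbinom-nonnegative : ∀ n k → 0ℤ ≤ k → k ≤ n → MonoTimesSelfRecip (qbinom n k) 0ℤ (k * (n - k))
qbinom-nonnegative (+ m) (+ k) (+≤+ _) (+≤+ k≤m) with m ℕ.∸ k | ℕₚ.m+[n∸m]≡n k≤m
... | l | refl = subst (MonoTimesSelfRecip _ 0ℤ) (trans (ℤₚ.pos-* l k) (degree (+ k) (+ l))) (qbinom-+-+ k l)
  where
  degree : ∀ x y → y * x ≡ x * ((x + y) - x)
  degree = solve-∀

qbinom-negative-nonnegative : ∀ n k → n < 0ℤ → 0ℤ ≤ k →
  MonoTimesSelfRecip (qbinom n k) (half (k * ((+ 2 * n) - k + 1ℤ))) (k * (- n - 1ℤ))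
qbinom-negative-nonnegative -[1+ a ] (+ c) -<+ (+≤+ _) =
  subst₂ (MonoTimesSelfRecip _) (sym exponent) (ℤₚ.pos-* c a) (qbinom-[1+]-+ a c)
  where
  expand : ∀ y x → x * ((+ 2 * - (1ℤ + y)) - x + 1ℤ) ≡ - (x * (y + y + x + 1ℤ))
  expand = solve-∀
  exponent : half (+ c * ((+ 2 * -[1+ a ]) - + c + 1ℤ)) ≡ - + sumFrom a c
  exponent = trans (cong half (expand (+ a) (+ c))) (half-neg-sumFrom a c)

qbinom-negative-negative : ∀ n k → k ≤ n → n < 0ℤ →
  MonoTimesSelfRecip (qbinom n k) (half (n * (n + 1ℤ) - k * (k + 1ℤ))) ((- n - 1ℤ) * (n - k))
qbinom-negative-negative -[1+ a ] -[1+ b ] (-≤- a≤b) -<+ with b ℕ.∸ a | ℕₚ.m+[n∸m]≡n a≤b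
... | c | refl = subst₂ (MonoTimesSelfRecip _) (sym exponent) degree (qbinom-[1+]-[1+] a c)
  where
  expand : ∀ y x → - (1ℤ + y) * (- (1ℤ + y) + 1ℤ) - - (1ℤ + (y + x)) * (- (1ℤ + (y + x)) + 1ℤ)
                   ≡ - (x * (y + y + x + 1ℤ))
  expand = solve-∀
  exponent : half (-[1+ a ] * (-[1+ a ] + 1ℤ) - -[1+ (a ℕ.+ c) ] * (-[1+ (a ℕ.+ c) ] + 1ℤ))
             ≡ - + sumFrom a c
  exponent = trans (cong half (expand (+ a) (+ c))) (half-neg-sumFrom a c)
  difference : ∀ y x → x * y ≡ y * (- (1ℤ + y) - - (1ℤ + (y + x)))
  difference = solve-∀
  degree : + (c ℕ.* a) ≡ (- -[1+ a ] - 1ℤ) * (-[1+ a ] - -[1+ (a ℕ.+ c) ])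
  degree = trans (ℤₚ.pos-* c a) (difference (+ a) (+ c))

corollary3p3 : (n k : ℤ) →
    ((0ℤ ≤ k) → (k ≤ n) → MonoTimesSelfRecip (qbinom n k) 0ℤ (k * (n - k)))
  × ((n < 0ℤ) → (0ℤ ≤ k) → MonoTimesSelfRecip (qbinom n k) (half (k * ((+ 2 * n) - k + 1ℤ))) (k * (- n - 1ℤ)))
  × ((k ≤ n) → (n < 0ℤ) → MonoTimesSelfRecip (qbinom n k) (half (n * (n + 1ℤ) - k * (k + 1ℤ))) ((- n - 1ℤ) * (n - k)))
corollary3p3 n k = qbinom-nonnegative n k , qbinom-negative-nonnegative n k , qbinom-negative-negative n k
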